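{- Let $A,A'$ be automata, let $(L,R,J)$ be live alignment conditions for $A,A'$, and let $\mathcal{Q}\subseteq Sto\times Sto'$. If $\prod(A,A',L,R,J)$ is manifestly $\mathcal{Q}$-adequate then it is $\mathcal{Q}$-adequate.
   Context: An automaton is $(Ctrl,Sto,init,fin,\Rightarrow)$ with $Sto$ a set, $Ctrl$ a finite set containing distinct $init,fin$, and ${\Rightarrow}\subseteq(Ctrl\times Sto)^2$ with $(n,s)\Rightarrow(m,t)$ implying $n\ne fin$ and $n\ne m$. For $A=(Ctrl,Sto,init,fin,\Rightarrow)$, $A'=(Ctrl',Sto',init',fin',\Rightarrow')$ and $L,R,J\subseteq(Ctrl\times Ctrl')\times(Sto\times Sto')$, the alignment automaton $\prod(A,A',L,R,J)$ has control points $Ctrl\times Ctrl'$, stores $Sto\times Sto'$, initial point $(init,init')$, final point $(fin,fin')$, and $((n,n'),(s,s'))\Rightarrow((m,m'),(t,t'))$ iff: ($\in L$, $(n,s)\Rightarrow(m,t)$, $(n',s')=(m',t')$) or ($\in R$, $(n,s)=(m,t)$, $(n',s')\Rightarrow'(m',t')$) or ($\in J$, $(n,s)\Rightarrow(m,t)$, $(n',s')\Rightarrow'(m',t')$). $(L,R,J)$ is live if states in $L$ have an $A$-successor on the left, states in $R$ an $A'$-successor on the right, states in $J$ both. $[fin|fin']$ is the set of states with control $(fin,fin')$. The alignment automaton is manifestly $\mathcal{Q}$-adequate if every state reachable from some $((init,init'),(s,s'))$ with $(s,s')\in\mathcal{Q}$ lies in $L\cup R\cup J\cup[fin|fin']$.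 It is $\mathcal{Q}$-adequate if for all $(s,s')\in\mathcal{Q}$ and $t,t'$ with $(init,s)\Rightarrow^*(fin,t)$ and $(init',s')\Rightarrow'^*(fin',t')$, we have $((init,init'),(s,s'))\Rightarrow^*((fin,fin'),(t,t'))$. -}

module Defs where

open import Level using (Level; _⊔_; suc)
open import Data.Nat using (ℕ)
open import Data.Fin using (Fin)
open import Data.Product using (_×_; _,_; Σ; ∃; ∃-syntax; proj₁)
open import Data.Sum using (_⊎_)
open import Relation.Nullary using (¬_)
open import Relation.Binary.PropositionalEquality using (_≡_)
open import Relation.Binary.Construct.Closure.ReflexiveTransitive using (Star)
open import Function.Bundles using (_↔_)

record Automaton : Set₁ where
  field
    Ctrl      : Set
    Sto       : Set
    ctrl-size : ℕ
    ctrl-fin  : Fin ctrl-size ↔ Ctrl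
    init      : Ctrl
    fin       : Ctrl
    init≢fin  : ¬ (init ≡ fin)
    _⇒_       : Ctrl × Sto → Ctrl × Sto → Set
    ⇒-notFin  : ∀ {n s m t} → (n , s) ⇒ (m , t) → ¬ (n ≡ fin)
    ⇒-moves   : ∀ {n s m t} → (n , s) ⇒ (m , t) → ¬ (n ≡ m)

  _⇒*_ : Ctrl × Sto → Ctrl × Sto → Set
  _⇒*_ = Star _⇒_

open Automaton

PState : Automaton → Automaton → Set
PState A A' = (Ctrl A × Ctrl A') × (Sto A × Sto A')

Cond : Automaton → Automaton → Set₁
Cond A A' = PState A A' → Set

data ProdStep (A A' : Automaton) (L R J : Cond A A') :
     PState A A' → PState A A' → Set where
  stepL : ∀ {n n' s s' m t} → L ((n , n') , (s , s')) →
          _⇒_ A (n , s) (m , t) →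
          ProdStep A A' L R J ((n , n') , (s , s')) ((m , n') , (t , s'))
  stepR : ∀ {n n' s s' m' t'} → R ((n , n') , (s , s')) →
          _⇒_ A' (n' , s') (m' , t') →
          ProdStep A A' L R J ((n , n') , (s , s')) ((n , m') , (s , t'))
  stepJ : ∀ {n n' s s' m m' t t'} → J ((n , n') , (s , s')) →
          _⇒_ A (n , s) (m , t) → _⇒_ A' (n' , s') (m' , t') →
          ProdStep A A' L R J ((n , n') , (s , s')) ((m , m') , (t , t'))

ProdStar : (A A' : Automaton) (L R J : Cond A A') → PState A A' → PState A A' → Set
ProdStar A A' L R J = Star (ProdStep A A' L R J)

Live : (A A' : Automaton) (L R J : Cond A A') → Set
Live A A' L R J =
  (∀ {n n' s s'} → L ((n , n') , (s , s')) → ∃[ m ] ∃[ t ] _⇒_ A (n , s) (m , t)) ×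
  (∀ {n n' s s'} → R ((n , n') , (s , s')) → ∃[ m' ] ∃[ t' ] _⇒_ A' (n' , s') (m' , t')) ×
  (∀ {n n' s s'} → J ((n , n') , (s , s')) →
      (∃[ m ] ∃[ t ] _⇒_ A (n , s) (m , t)) × (∃[ m' ] ∃[ t' ] _⇒_ A' (n' , s') (m' , t')))

ManifestlyAdequate : (A A' : Automaton) (L R J : Cond A A') →
                     (Sto A × Sto A' → Set) → Set
ManifestlyAdequate A A' L R J Q =
  ∀ s s' (σ : PState A A') → Q (s , s') →
  ProdStar A A' L R J ((init A , init A') , (s , s')) σ →
  L σ ⊎ R σ ⊎ J σ ⊎ (proj₁ σ ≡ (fin A , fin A'))

Adequate : (A A' : Automaton) (L R J : Cond A A') →
           (Sto A × Sto A' → Set) → Set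
Adequate A A' L R J Q =
  ∀ s s' t t' → Q (s , s') →
  _⇒*_ A (init A , s) (fin A , t) →
  _⇒*_ A' (init A' , s') (fin A' , t') →
  ProdStar A A' L R J ((init A , init A') , (s , s')) ((fin A , fin A') , (t , t'))

{-# OPTIONS --safe #-}
-- Walk along the two given runs, keeping an aligned product run of what has been consumed so far.
-- Manifest adequacy says the current product state lies in L, R, J or [fin|fin'] and thus which
-- side(s) to advance. Liveness guarantees that a side to be advanced has a successor, so it is not
-- at its final point and its remaining run is nonempty; at (fin, fin') both remaining runs are empty,
-- because the final point has no successor. Each step shortens the remaining runs.
module Submission where

open import Defs
open import Data.Product using (_×_; _,_; ∃-syntax; proj₁; proj₂)
open import Data.Sum using (inj₁; inj₂)
open import Data.Empty using (⊥-elim)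
open import Relation.Nullary using (¬_)
open import Relation.Binary.PropositionalEquality using (_≡_; refl)
open import Relation.Binary.Construct.Closure.ReflexiveTransitive using (ε; _◅_; _◅◅_)
open Automaton

has-successor⇒≢fin : (A : Automaton) {n : Ctrl A} {s : Sto A} →
                     ∃[ m ] ∃[ t ] _⇒_ A (n , s) (m , t) → ¬ n ≡ fin A
has-successor⇒≢fin A (_ , _ , step) = ⇒-notFin A step

module Alignment {A A' : Automaton} {L R J : Cond A A'} (live : Live A A' L R J) where

  L⇒≢fin : ∀ {n n' s s'} → L ((n , n') , (s , s')) → ¬ n ≡ fin A
  L⇒≢fin inL = has-successor⇒≢fin A (proj₁ live inL)

  R⇒≢fin' : ∀ {n n' s s'} → R ((n , n') , (s , s')) → ¬ n' ≡ fin A'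
  R⇒≢fin' inR = has-successor⇒≢fin A' (proj₁ (proj₂ live) inR)

  J⇒≢fin : ∀ {n n' s s'} → J ((n , n') , (s , s')) → ¬ n ≡ fin A
  J⇒≢fin inJ = has-successor⇒≢fin A (proj₁ (proj₂ (proj₂ live) inJ))

  J⇒≢fin' : ∀ {n n' s s'} → J ((n , n') , (s , s')) → ¬ n' ≡ fin A'
  J⇒≢fin' inJ = has-successor⇒≢fin A' (proj₂ (proj₂ (proj₂ live) inJ))

  module _ {Q : Sto A × Sto A' → Set} (manifest : ManifestlyAdequate A A' L R J Q)
           {s : Sto A} {s' : Sto A'} (q : Q (s , s')) {t : Sto A} {t' : Sto A'} where

    Reachable : PState A A' → Set
    Reachable = ProdStar A A' L R J ((init A , init A') , (s , s'))

    align-runs : ∀ {n n' u u'} → Reachable ((n , n') , (u , u')) →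
                 _⇒*_ A (n , u) (fin A , t) → _⇒*_ A' (n' , u') (fin A' , t') →
                 Reachable ((fin A , fin A') , (t , t'))
    align-runs prefix run run' with manifest _ _ _ q prefix
    align-runs prefix (step ◅ run) run'           | inj₁ inL =
      align-runs (prefix ◅◅ stepL inL step ◅ ε) run run'
    align-runs prefix ε            run'           | inj₁ inL = ⊥-elim (L⇒≢fin inL refl)
    align-runs prefix run          (step' ◅ run') | inj₂ (inj₁ inR) =
      align-runs (prefix ◅◅ stepR inR step' ◅ ε) run run'
    align-runs prefix run          ε              | inj₂ (inj₁ inR) = ⊥-elim (R⇒≢fin' inR refl)
    align-runs prefix (step ◅ run) (step' ◅ run') | inj₂ (inj₂ (inj₁ inJ)) =
      align-runs (prefix ◅◅ stepJ inJ step step' ◅ ε) run run'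
    align-runs prefix ε            run'           | inj₂ (inj₂ (inj₁ inJ)) = ⊥-elim (J⇒≢fin inJ refl)
    align-runs prefix run          ε              | inj₂ (inj₂ (inj₁ inJ)) = ⊥-elim (J⇒≢fin' inJ refl)
    align-runs prefix ε            ε              | inj₂ (inj₂ (inj₂ _)) = prefix
    align-runs prefix (step ◅ _)   _              | inj₂ (inj₂ (inj₂ refl)) = ⊥-elim (⇒-notFin A step refl)
    align-runs prefix ε            (step' ◅ _)    | inj₂ (inj₂ (inj₂ refl)) = ⊥-elim (⇒-notFin A' step' refl)

lemma3p9 : (A A' : Automaton) (L R J : Cond A A')
           (Q : Automaton.Sto A × Automaton.Sto A' → Set) →
           Live A A' L R J →
           ManifestlyAdequate A A' L R J Q →
           Adequate A A' L R J Q
lemma3p9 A A' L R J Q live manifest s s' t t' q run run' =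
  Alignment.align-runs live manifest q ε run run'
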